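{- Let $\mathcal{J}$ be a small category and $M$ a model of the presheaf theory $\mathbb{T}^{\mathcal{J}}$. Then the set of elements $([s_i])_{i}\in\prod_{i\in\mathcal{J}}M\langle\mathsf{x}_i\rangle_i$ that are invertible and commute generically with all function symbols (which is the covariant isotropy group $\mathcal{Z}(M)$ under its syntactic identification) equals \[ \Big\{ \big([\psi_i(\mathsf{x}_i)]\big)_i \in \prod_{i \in \mathcal{J}} M\langle \mathsf{x}_i \rangle_i \colon \psi \in \mathsf{Aut}(\mathsf{Id}_\mathcal{J})\Big\}. \]
   Context: The presheaf theory $\mathbb{T}^{\mathcal{J}}$ is the quasi-equational theory with one sort $i$ per object $i$ of $\mathcal{J}$ and one unary function symbol $f:i\to j$ per arrow $f:i\to j$, with axioms making each $f$ total, $\mathsf{id}_i(x)=x$, and $g(f(x))=(g\circ f)(x)$; its models are functors $\mathcal{J}\to\mathsf{Set}$. For a model $M$ and object $i$, $\mathbb{T}^{\mathcal{J}}(M,\mathsf{x}_i)$ extends $\mathbb{T}^{\mathcal{J}}$ by constants for all elements of $M$ (with axioms $\overline{M(f)(a)}=f(\overline a)$) and a new defined constant $\mathsf{x}_i:i$; more generally $\mathbb{T}^{\mathcal{J}}(M,\mathsf{x}_1,\dots,\mathsf{x}_n)$ adds several new constants. $M\langle\mathsf{x}_i\rangle_k$ is the set of closed terms of sort $k$ of $\mathbb{T}^{\mathcal{J}}(M,\mathsf{x}_i)$ modulo provable equality; $M\langle\mathsf{x}_i\rangle_i$ is a monoid under substitution for $\mathsf{x}_i$. A family $([s_i])_i$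 is invertible if each $s_i$ has $s_i^{ -1}$ with $s_i[s_i^{ -1}/\mathsf{x}_i]=\mathsf{x}_i=s_i^{ -1}[s_i/\mathsf{x}_i]$ provable in $\mathbb{T}^{\mathcal{J}}(M,\mathsf{x}_i)$; it commutes generically with $f:j\to k$ if $\mathbb{T}^{\mathcal{J}}(M,\mathsf{x}_1)$ (with $\mathsf{x}_1:j$) proves $s_k[f(\mathsf{x}_1)/\mathsf{x}_k]=f(s_j[\mathsf{x}_1/\mathsf{x}_j])$. $\mathsf{Aut}(\mathsf{Id}_{\mathcal{J}})$ is the group of natural automorphisms $\psi=(\psi_i:i\to i)_i$ of the identity functor on $\mathcal{J}$, and $\psi_i(\mathsf{x}_i)$ is the term obtained by applying the function symbol $\psi_i$ to $\mathsf{x}_i$. -}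

module Defs where

open import Level using (zero)
open import Data.Product using (Σ; _×_; _,_)
open import Relation.Binary.PropositionalEquality using (_≡_)

record Category : Set₁ where
  field
    Obj  : Set
    Hom  : Obj → Obj → Set
    id   : (i : Obj) → Hom i i
    _∘_  : {i j k : Obj} → Hom j k → Hom i j → Hom i k
    idˡ  : {i j : Obj} (f : Hom i j) → (id j ∘ f) ≡ f
    idʳ  : {i j : Obj} (f : Hom i j) → (f ∘ id i) ≡ f
    assoc : {i j k l : Obj} (h : Hom k l) (g : Hom j k) (f : Hom i j) →
            ((h ∘ g) ∘ f) ≡ (h ∘ (g ∘ f))

-- A model of the presheaf theory T^J = a functor J → Set.
record PresheafModel (C : Category) : Set₁ where
  open Category C
  field
    F₀    : Obj → Set
    F₁    : {i j : Obj} → Hom i j → F₀ i → F₀ j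
    F-id  : (i : Obj) (a : F₀ i) → F₁ (id i) a ≡ a
    F-∘   : {i j k : Obj} (g : Hom j k) (f : Hom i j) (a : F₀ i) →
            F₁ (g ∘ f) a ≡ F₁ g (F₁ f a)

module Syntax (C : Category) (M : PresheafModel C) where
  open Category C
  open PresheafModel M

  -- Closed terms of sort k of T^J(M, x) where the single new constant x has sort v.
  data Term (v : Obj) : Obj → Set where
    var : Term v v
    con : {k : Obj} → F₀ k → Term v k
    app : {j k : Obj} → Hom j k → Term v j → Term v k

  _[_] : {v w k : Obj} → Term v k → Term w v → Term w k
  var       [ u ] = u
  con a     [ u ] = con a
  app f t   [ u ] = app f (t [ u ])

  -- Provable equality in T^J(M, x): the congruence generated by the axioms
  -- id(t) = t, g(f(t)) = (g∘f)(t), and  ‾(M(f)(a)) = f(‾a).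
  -- (All function symbols are total, so every closed term is defined.)
  data _≈_ {v : Obj} : {k : Obj} → Term v k → Term v k → Set where
    ≈-refl  : {k : Obj} {t : Term v k} → t ≈ t
    ≈-sym   : {k : Obj} {t u : Term v k} → t ≈ u → u ≈ t
    ≈-trans : {k : Obj} {t u w : Term v k} → t ≈ u → u ≈ w → t ≈ w
    ≈-app   : {j k : Obj} (f : Hom j k) {t u : Term v j} → t ≈ u → app f t ≈ app f u
    ax-id   : {k : Obj} (t : Term v k) → app (id k) t ≈ t
    ax-∘    : {i j k : Obj} (g : Hom j k) (f : Hom i j) (t : Term v i) →
              app g (app f t) ≈ app (g ∘ f) t
    ax-con  : {j k : Obj} (f : Hom j k) (a : F₀ j) → con (F₁ f a) ≈ app f (con a)

  -- A family (s_i)_i with s_i ∈ M⟨x_i⟩_i (representatives of classes).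
  Family : Set
  Family = (i : Obj) → Term i i

  Invertible : Family → Set
  Invertible s = (i : Obj) → Σ (Term i i) λ s⁻¹ →
    ((s i [ s⁻¹ ]) ≈ var) × ((s⁻¹ [ s i ]) ≈ var)

  CommutesGenerically : Family → {j k : Obj} → Hom j k → Set
  CommutesGenerically s {j} {k} f = (s k [ app f var ]) ≈ app f (s j [ var ])

record NatAutId (C : Category) : Set where
  open Category C
  field
    ψ        : (i : Obj) → Hom i i
    ψ⁻¹      : (i : Obj) → Hom i i
    inv-l    : (i : Obj) → (ψ⁻¹ i ∘ ψ i) ≡ id i
    inv-r    : (i : Obj) → (ψ i ∘ ψ⁻¹ i) ≡ id i
    natural  : {j k : Obj} (f : Hom j k) → (f ∘ ψ j) ≡ (ψ k ∘ f)

-- Every closed term of T^J(M, x) with x : v is provably equal to a constant ā (a ∈ M(k)) or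
-- to a generic term f(x) with f : v → k, and these normal forms are distinct; that is,
-- M⟨x⟩ is M + y(v). A constant stays a constant under substitution, so an invertible s_i
-- must be ψ_i(x), its inverse ψ⁻¹_i(x), and substitution composes these arrows. Invertibility
-- of s then says each ψ_i is an isomorphism, and generic commutation with f says f ∘ ψ_j = ψ_k ∘ f.
module Submission where

open import Defs
open import Data.Empty using (⊥; ⊥-elim)
open import Data.Product using (Σ; _×_; _,_; proj₁; proj₂)
open import Data.Sum using (_⊎_; inj₁; inj₂)
open import Data.Sum.Properties using (inj₂-injective)
open import Function.Bundles using (_⇔_; mk⇔)
open import Relation.Binary.Bundles using (Setoid)
open import Relation.Binary.PropositionalEquality
  using (_≡_; refl; sym; trans; cong; subst; module ≡-Reasoning)
import Relation.Binary.Reasoning.Setoid as SetoidReasoning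

module Isotropy (C : Category) (M : PresheafModel C) where
  open Category C
  open PresheafModel M
  open Syntax C M

  ≈-setoid : Obj → Obj → Setoid _ _
  ≈-setoid v k = record
    { Carrier       = Term v k
    ; _≈_           = _≈_
    ; isEquivalence = record { refl = ≈-refl ; sym = ≈-sym ; trans = ≈-trans }
    }

  NormalForm : Obj → Obj → Set
  NormalForm v k = F₀ k ⊎ Hom v k

  act : {v j k : Obj} → Hom j k → NormalForm v j → NormalForm v k
  act f (inj₁ a) = inj₁ (F₁ f a)
  act f (inj₂ g) = inj₂ (f ∘ g)

  normalise : {v k : Obj} → Term v k → NormalForm v k
  normalise {v} var   = inj₂ (id v)
  normalise (con a)   = inj₁ a
  normalise (app f t) = act f (normalise t)

  reflect : {v k : Obj} → NormalForm v k → Term v k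
  reflect (inj₁ a) = con a
  reflect (inj₂ g) = app g var

  act-id : {v k : Obj} (n : NormalForm v k) → act (id k) n ≡ n
  act-id (inj₁ a) = cong inj₁ (F-id _ a)
  act-id (inj₂ g) = cong inj₂ (idˡ g)

  act-∘ : {v i j k : Obj} (g : Hom j k) (f : Hom i j) (n : NormalForm v i) →
          act g (act f n) ≡ act (g ∘ f) n
  act-∘ g f (inj₁ a) = cong inj₁ (sym (F-∘ g f a))
  act-∘ g f (inj₂ h) = cong inj₂ (sym (assoc g f h))

  normalise-sound : {v k : Obj} {t u : Term v k} → t ≈ u → normalise t ≡ normalise u
  normalise-sound ≈-refl         = refl
  normalise-sound (≈-sym p)      = sym (normalise-sound p)
  normalise-sound (≈-trans p q)  = trans (normalise-sound p) (normalise-sound q)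
  normalise-sound (≈-app f p)    = cong (act f) (normalise-sound p)
  normalise-sound (ax-id t)      = act-id (normalise t)
  normalise-sound (ax-∘ g f t)   = act-∘ g f (normalise t)
  normalise-sound (ax-con f a)   = refl

  app-reflect : {v j k : Obj} (f : Hom j k) (n : NormalForm v j) →
                app f (reflect n) ≈ reflect (act f n)
  app-reflect f (inj₁ a) = ≈-sym (ax-con f a)
  app-reflect f (inj₂ g) = ax-∘ f g var

  ≈-reflect-normalise : {v k : Obj} (t : Term v k) → t ≈ reflect (normalise t)
  ≈-reflect-normalise var       = ≈-sym (ax-id var)
  ≈-reflect-normalise (con a)   = ≈-refl
  ≈-reflect-normalise (app f t) =
    ≈-trans (≈-app f (≈-reflect-normalise t)) (app-reflect f (normalise t))

  _⟨_⟩ : {v w k : Obj} → NormalForm v k → NormalForm w v → NormalForm w k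
  inj₁ a ⟨ n ⟩ = inj₁ a
  inj₂ g ⟨ n ⟩ = act g n

  act-⟨⟩ : {v w j k : Obj} (g : Hom j k) (n : NormalForm v j) (m : NormalForm w v) →
           act g (n ⟨ m ⟩) ≡ act g n ⟨ m ⟩
  act-⟨⟩ g (inj₁ a) m = refl
  act-⟨⟩ g (inj₂ f) m = act-∘ g f m

  normalise-[] : {v w k : Obj} (t : Term v k) (u : Term w v) →
                 normalise (t [ u ]) ≡ normalise t ⟨ normalise u ⟩
  normalise-[] var       u = sym (act-id (normalise u))
  normalise-[] (con a)   u = refl
  normalise-[] (app g t) u =
    trans (cong (act g) (normalise-[] t u)) (act-⟨⟩ g (normalise t) (normalise u))

  app-var-injective : {v k : Obj} {g h : Hom v k} → app g var ≈ app h var → g ≡ h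
  app-var-injective {g = g} {h} p =
    trans (sym (idʳ g)) (trans (inj₂-injective (normalise-sound p)) (idʳ h))

  -- The constant case is impossible: substitution leaves a constant unchanged, and no constant
  -- is provably equal to x.
  []≈var⇒generic : {v w : Obj} (t : Term v w) {u : Term w v} → (t [ u ]) ≈ var →
                   Σ (Hom v w) λ g → t ≈ app g var
  []≈var⇒generic {w = w} t {u} p with normalise t in eq
  ... | inj₂ g = g , subst (λ n → t ≈ reflect n) eq (≈-reflect-normalise t)
  ... | inj₁ a = ⊥-elim (constant≢generic (begin
    inj₁ a                          ≡⟨ cong (_⟨ normalise u ⟩) eq ⟨
    normalise t ⟨ normalise u ⟩     ≡⟨ normalise-[] t u ⟨
    normalise (t [ u ])             ≡⟨ normalise-sound p ⟩
    inj₂ (id _)                     ∎))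
    where
    open ≡-Reasoning
    constant≢generic : {b : F₀ w} {g : Hom w w} → _≡_ {A = NormalForm w w} (inj₁ b) (inj₂ g) → ⊥
    constant≢generic ()

  []-congˡ : {v w k : Obj} {t t′ : Term v k} (u : Term w v) → t ≈ t′ → (t [ u ]) ≈ (t′ [ u ])
  []-congˡ u ≈-refl         = ≈-refl
  []-congˡ u (≈-sym p)      = ≈-sym ([]-congˡ u p)
  []-congˡ u (≈-trans p q)  = ≈-trans ([]-congˡ u p) ([]-congˡ u q)
  []-congˡ u (≈-app f p)    = ≈-app f ([]-congˡ u p)
  []-congˡ u (ax-id t)      = ax-id (t [ u ])
  []-congˡ u (ax-∘ g f t)   = ax-∘ g f (t [ u ])
  []-congˡ u (ax-con f a)   = ax-con f a

  []-var : {v k : Obj} (t : Term v k) → t [ var ] ≡ t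
  []-var var       = refl
  []-var (con a)   = refl
  []-var (app f t) = cong (app f) ([]-var t)

  generic-[] : {u v w : Obj} {t : Term v w} {s : Term u v} {g : Hom v w} {h : Hom u v} →
               t ≈ app g var → s ≈ app h var → (t [ s ]) ≈ app (g ∘ h) var
  generic-[] {t = t} {s} {g} {h} t≈g s≈h = begin
    t [ s ]               ≈⟨ []-congˡ s t≈g ⟩
    app g s               ≈⟨ ≈-app g s≈h ⟩
    app g (app h var)     ≈⟨ ax-∘ g h var ⟩
    app (g ∘ h) var       ∎
    where open SetoidReasoning (≈-setoid _ _)

  Isotropic : Family → Set
  Isotropic s = Invertible s × ({j k : Obj} (f : Hom j k) → CommutesGenerically s f)

  InducedBy : NatAutId C → Family → Set
  InducedBy ψ s = (i : Obj) → s i ≈ app (NatAutId.ψ ψ i) var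

  isotropic⇒induced : (s : Family) → Isotropic s → Σ (NatAutId C) λ ψ → InducedBy ψ s
  isotropic⇒induced s (invertible , commutes) = ψ-aut , s≈ψ
    where
    s⁻¹ : Family
    s⁻¹ i = proj₁ (invertible i)

    s∘s⁻¹ : (i : Obj) → (s i [ s⁻¹ i ]) ≈ var
    s∘s⁻¹ i = proj₁ (proj₂ (invertible i))

    s⁻¹∘s : (i : Obj) → (s⁻¹ i [ s i ]) ≈ var
    s⁻¹∘s i = proj₂ (proj₂ (invertible i))

    ψ ψ⁻¹ : (i : Obj) → Hom i i
    ψ   i = proj₁ ([]≈var⇒generic (s i) (s∘s⁻¹ i))
    ψ⁻¹ i = proj₁ ([]≈var⇒generic (s⁻¹ i) (s⁻¹∘s i))

    s≈ψ : (i : Obj) → s i ≈ app (ψ i) var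
    s≈ψ i = proj₂ ([]≈var⇒generic (s i) (s∘s⁻¹ i))

    s⁻¹≈ψ⁻¹ : (i : Obj) → s⁻¹ i ≈ app (ψ⁻¹ i) var
    s⁻¹≈ψ⁻¹ i = proj₂ ([]≈var⇒generic (s⁻¹ i) (s⁻¹∘s i))

    generic≈var⇒≡id : {i : Obj} {g : Hom i i} {t : Term i i} → t ≈ app g var → t ≈ var → g ≡ id i
    generic≈var⇒≡id t≈g t≈var =
      app-var-injective (≈-trans (≈-sym t≈g) (≈-trans t≈var (≈-sym (ax-id var))))

    natural : {j k : Obj} (f : Hom j k) → (f ∘ ψ j) ≡ (ψ k ∘ f)
    natural {j} {k} f = app-var-injective (begin
      app (f ∘ ψ j) var       ≈⟨ ax-∘ f (ψ j) var ⟨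
      app f (app (ψ j) var)   ≈⟨ ≈-app f (s≈ψ j) ⟨
      app f (s j)             ≡⟨ cong (app f) ([]-var (s j)) ⟨
      app f (s j [ var ])     ≈⟨ commutes f ⟨
      s k [ app f var ]       ≈⟨ generic-[] (s≈ψ k) ≈-refl ⟩
      app (ψ k ∘ f) var       ∎)
      where open SetoidReasoning (≈-setoid _ _)

    ψ-aut : NatAutId C
    ψ-aut = record
      { ψ       = ψ
      ; ψ⁻¹     = ψ⁻¹
      ; inv-l   = λ i → generic≈var⇒≡id (generic-[] (s⁻¹≈ψ⁻¹ i) (s≈ψ i)) (s⁻¹∘s i)
      ; inv-r   = λ i → generic≈var⇒≡id (generic-[] (s≈ψ i) (s⁻¹≈ψ⁻¹ i)) (s∘s⁻¹ i)
      ; natural = natural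
      }

  induced⇒isotropic : (s : Family) → Σ (NatAutId C) (λ ψ → InducedBy ψ s) → Isotropic s
  induced⇒isotropic s (ψ-aut , s≈ψ) = invertible , commutes
    where
    open NatAutId ψ-aut

    app-id-var : {i : Obj} {g : Hom i i} → g ≡ id i → app g var ≈ var
    app-id-var refl = ax-id var

    invertible : Invertible s
    invertible i = app (ψ⁻¹ i) var
                 , ≈-trans (generic-[] (s≈ψ i) ≈-refl) (app-id-var (inv-r i))
                 , ≈-trans (generic-[] ≈-refl (s≈ψ i)) (app-id-var (inv-l i))

    commutes : {j k : Obj} (f : Hom j k) → CommutesGenerically s f
    commutes {j} {k} f = begin
      s k [ app f var ]       ≈⟨ generic-[] (s≈ψ k) ≈-refl ⟩
      app (ψ k ∘ f) var       ≡⟨ cong (λ g → app g var) (natural f) ⟨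
      app (f ∘ ψ j) var       ≈⟨ ax-∘ f (ψ j) var ⟨
      app f (app (ψ j) var)   ≈⟨ ≈-app f (s≈ψ j) ⟨
      app f (s j)             ≡⟨ cong (app f) ([]-var (s j)) ⟨
      app f (s j [ var ])     ∎
      where open SetoidReasoning (≈-setoid _ _)

proposition21 : (C : Category) (M : PresheafModel C) →
    let open Category C
        open Syntax C M
    in (s : Family) →
       (Invertible s × ({j k : Obj} (f : Hom j k) → CommutesGenerically s f))
       ⇔ Σ (NatAutId C) (λ ψ → (i : Obj) → s i ≈ app (NatAutId.ψ ψ i) var)
proposition21 C M s = mk⇔ (isotropic⇒induced s) (induced⇒isotropic s)
  where open Isotropy C M
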